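{- Let $k,D,N$ be positive integers with $k\ge D$. Then the number of triples $(D',a,b)$ with $D'\in\{1,\dots,D\}$ and $a,b\in\mathbb{R}$ such that there exists a $k$-term progression of type $(D',a,b)$ all of whose terms lie in $\{1,2,\dots,N\}$ is less than $2^{D+1}N^2$.
   Context: The difference operator $\Delta$ sends a finite sequence $(a_i)_{i=1}^k$ to $(a_{v+1}-a_v)_{v=1}^{k-1}$; $\Delta^m$ is its $m$-fold iterate. For integers $k\ge m\ge 1$, a $k$-term progression of type $(m,a,b)$ is a nonconstant sequence $a_1,a_2,\dots,a_k$ with $a_1=a$ such that $\Delta^m(a_i)$ is the constant sequence all of whose entries equal $b$, where $b\neq 0$. -}

module Defs where

open import Data.Nat using (ℕ; zero; suc; _≤_; _∸_)
open import Data.Integer using (ℤ; _-_; +_) renaming (_≤_ to _≤ℤ_)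
open import Data.List using (List; []; _∷_; length)
open import Data.List.Relation.Unary.All using (All)
open import Data.List.Membership.Propositional using (_∈_)
open import Data.Product using (Σ; ∃; ∃-syntax; _×_; _,_)
open import Relation.Binary.PropositionalEquality using (_≡_; _≢_)

Δ : List ℤ → List ℤ
Δ [] = []
Δ (x ∷ []) = []
Δ (x ∷ y ∷ r) = (y - x) ∷ Δ (y ∷ r)

Δ^ : ℕ → List ℤ → List ℤ
Δ^ zero xs = xs
Δ^ (suc m) xs = Δ^ m (Δ xs)

Nonconstant : List ℤ → Set
Nonconstant xs = ∃[ x ] ∃[ y ] (x ∈ xs × y ∈ xs × x ≢ y)

ConstantSeq : ℤ → List ℤ → Set
ConstantSeq b ys = ys ≢ [] × All (_≡ b) ys

Progression : ℕ → ℕ → ℤ → ℤ → List ℤ → Set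
Progression k m a b xs =
  m ≤ k × length xs ≡ k × Nonconstant xs × (∃[ t ] xs ≡ a ∷ t)
  × b ≢ + 0 × ConstantSeq b (Δ^ m xs)

InRange : ℕ → List ℤ → Set
InRange N xs = All (λ x → (+ 1 ≤ℤ x) × (x ≤ℤ + N)) xs

Counted : ℕ → ℕ → ℕ → ℕ × ℤ × ℤ → Set
Counted k D N (D' , a , b) =
  1 ≤ D' × D' ≤ D × (∃[ xs ] (Progression k D' a b xs × InRange N xs))

{-# OPTIONS --safe #-}
module Submission where

-- A counted triple (D', a, b) has 1 ≤ a ≤ N, and since the entries of Δ lie in [1 - N, N - 1]
-- and each further Δ at most doubles absolute values, |b| ≤ 2^(D'-1) (N - 1).  So for each
-- D' there are at most N (2^D' (N - 1) + 1) choices of (a, b); summing over D' ≤ D gives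
-- N ((2^(D+1) - 2)(N - 1) + D), which is less than 2^(D+1) N².

open import Defs
open import Data.Nat using (ℕ; zero; suc; z≤n; s≤s; _≤_; _<_; _+_; _*_; _^_)
import Data.Nat.Properties as ℕ
import Data.Nat.Tactic.RingSolver as ℕ-Solver
open import Data.Integer using (ℤ; +_; -_)
  renaming (_+_ to _+ℤ_; _-_ to _-ℤ_; _≤_ to _≤ℤ_; suc to sucℤ)
import Data.Integer.Properties as ℤ
import Data.Integer.Tactic.RingSolver as ℤ-Solver
open import Data.Product using (_×_; _,_)
open import Data.Sum using (inj₁; inj₂)
open import Data.Empty using (⊥-elim)
open import Data.List using (List; []; _∷_; _++_; length; map; cartesianProductWith)
open import Data.List.Properties using (length-++; length-map; length-removeAt′)
open import Data.List.Relation.Unary.All using (All; []; _∷_; lookup)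
import Data.List.Relation.Unary.All as All
open import Data.List.Relation.Unary.Any using (here; there; index; _─_)
open import Data.List.Relation.Unary.AllPairs using (_∷_)
open import Data.List.Relation.Unary.Unique.Propositional using (Unique)
open import Data.List.Membership.Propositional using (_∈_)
open import Data.List.Membership.Propositional.Properties
  using (∈-++⁺ˡ; ∈-++⁺ʳ; ∈-map⁺; ∈-cartesianProductWith⁺)
open import Data.List.Relation.Binary.Subset.Propositional using (_⊆_)
open import Relation.Nullary using (yes; no)
open import Relation.Binary.PropositionalEquality
open import Function using (_∘_)

module _ {A : Set} where

  ∈-─⁺ : ∀ {x y : A} {ys} (x∈ys : x ∈ ys) → y ∈ ys → x ≢ y → y ∈ (ys ─ x∈ys)
  ∈-─⁺ (here refl) (here refl) x≢y = ⊥-elim (x≢y refl)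
  ∈-─⁺ (here _)    (there y∈)  _   = y∈
  ∈-─⁺ (there _)   (here y≡)   _   = here y≡
  ∈-─⁺ (there x∈)  (there y∈)  x≢y = there (∈-─⁺ x∈ y∈ x≢y)

  Unique-⊆⇒length≤ : ∀ {xs ys : List A} → Unique xs → xs ⊆ ys → length xs ≤ length ys
  Unique-⊆⇒length≤ {[]}     _            _  = z≤n
  Unique-⊆⇒length≤ {x ∷ xs} {ys} (x≢xs ∷ u) xs⊆ys =
    subst (suc (length xs) ≤_) (sym (length-removeAt′ ys (index x∈ys)))
      (s≤s (Unique-⊆⇒length≤ u λ y∈xs → ∈-─⁺ x∈ys (xs⊆ys (there y∈xs)) (lookup x≢xs y∈xs)))
    where
    x∈ys : x ∈ ys
    x∈ys = xs⊆ys (here refl)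

module _ {A B C : Set} (f : A → B → C) where

  length-cartesianProductWith : ∀ xs ys →
    length (cartesianProductWith f xs ys) ≡ length xs * length ys
  length-cartesianProductWith []       ys = refl
  length-cartesianProductWith (x ∷ xs) ys = begin
    length (map (f x) ys ++ cartesianProductWith f xs ys)
      ≡⟨ length-++ (map (f x) ys) ⟩
    length (map (f x) ys) + length (cartesianProductWith f xs ys)
      ≡⟨ cong₂ _+_ (length-map (f x) ys) (length-cartesianProductWith xs ys) ⟩
    length ys + length xs * length ys ∎
    where open ≡-Reasoning

Between : ℤ → ℤ → ℤ → Set
Between lo hi x = lo ≤ℤ x × x ≤ℤ hi

range : ℤ → ℕ → List ℤ
range lo zero    = []
range lo (suc c) = lo ∷ range (sucℤ lo) c

length-range : ∀ lo c → length (range lo c) ≡ c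
length-range lo zero    = refl
length-range lo (suc c) = cong suc (length-range (sucℤ lo) c)

∈-range : ∀ {lo x} c → Between lo (lo +ℤ + c) x → x ∈ range lo (suc c)
∈-range {lo} {x} zero (lo≤x , x≤lo+0) = here (ℤ.≤-antisym (subst (x ≤ℤ_) (ℤ.+-identityʳ lo) x≤lo+0) lo≤x)
∈-range {lo} {x} (suc c) (lo≤x , x≤hi) with x ℤ.≟ lo
... | yes x≡lo = here x≡lo
... | no  x≢lo = there (∈-range c (ℤ.i<j⇒suc[i]≤j (ℤ.≤∧≢⇒< lo≤x (x≢lo ∘ sym)) , subst (x ≤ℤ_) hi≡ x≤hi))
  where
  hi≡ : lo +ℤ + suc c ≡ sucℤ lo +ℤ + c
  hi≡ = shift lo (+ c)
    where
    shift : ∀ i j → i +ℤ (+ 1 +ℤ j) ≡ (+ 1 +ℤ i) +ℤ j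
    shift = ℤ-Solver.solve-∀

Δ-Between : ∀ {lo hi} xs → All (Between lo hi) xs → All (Between (lo -ℤ hi) (hi -ℤ lo)) (Δ xs)
Δ-Between []          _ = []
Δ-Between (x ∷ [])    _ = []
Δ-Between (x ∷ y ∷ r) ((lo≤x , x≤hi) ∷ (lo≤y , y≤hi) ∷ r∈) =
  (ℤ.+-mono-≤ lo≤y (ℤ.neg-mono-≤ x≤hi) , ℤ.+-mono-≤ y≤hi (ℤ.neg-mono-≤ lo≤x))
  ∷ Δ-Between (y ∷ r) ((lo≤y , y≤hi) ∷ r∈)

All-Between-cong : ∀ {lo lo′ hi hi′ xs} → lo ≡ lo′ → hi ≡ hi′ →
  All (Between lo hi) xs → All (Between lo′ hi′) xs
All-Between-cong refl refl bounded = bounded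

Bounded : ℕ → ℤ → Set
Bounded w = Between (- + w) (+ w)

Δ-Bounded : ∀ {w} xs → All (Bounded w) xs → All (Bounded (w + w)) (Δ xs)
Δ-Bounded {w} xs bounded = All-Between-cong lo≡ hi≡ (Δ-Between xs bounded)
  where
  lo≡ : - + w -ℤ + w ≡ - (+ w +ℤ + w)
  lo≡ = sym (ℤ.neg-distrib-+ (+ w) (+ w))
  hi≡ : + w -ℤ - + w ≡ + w +ℤ + w
  hi≡ = cong (+ w +ℤ_) (ℤ.neg-involutive (+ w))

Δ^-Bounded : ∀ d {w} xs → All (Bounded w) xs → All (Bounded (2 ^ d * w)) (Δ^ d xs)
Δ^-Bounded zero    {w} xs bounded = subst (λ v → All (Bounded v) xs) (sym (ℕ.+-identityʳ w)) bounded
Δ^-Bounded (suc d) {w} xs bounded =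
  subst (λ v → All (Bounded v) (Δ^ d (Δ xs))) (doubling (2 ^ d) w)
    (Δ^-Bounded d (Δ xs) (Δ-Bounded xs bounded))
  where
  doubling : ∀ p w → p * (w + w) ≡ 2 * p * w
  doubling = ℕ-Solver.solve-∀

Δ-InRange : ∀ n xs → InRange (suc n) xs → All (Bounded n) (Δ xs)
Δ-InRange n xs inRange = All-Between-cong (lo≡ n) (hi≡ n) (Δ-Between xs inRange)
  where
  lo≡ : ∀ n → + 1 -ℤ + suc n ≡ - + n
  lo≡ zero    = refl
  lo≡ (suc n) = refl
  hi≡ : ∀ n → + suc n -ℤ + 1 ≡ + n
  hi≡ zero    = refl
  hi≡ (suc n) = refl

ConstantSeq-All : ∀ {P : ℤ → Set} {b ys} → ConstantSeq b ys → All P ys → P b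
ConstantSeq-All {ys = []}    (nonempty , _) _        = ⊥-elim (nonempty refl)
ConstantSeq-All {ys = y ∷ _} (_ , refl ∷ _) (Py ∷ _) = Py

Progression-InRange⇒Bounded : ∀ {k d a b n xs} → Progression k (suc d) a b xs → InRange (suc n) xs →
  Bounded (2 ^ d * n) b
Progression-InRange⇒Bounded {d = d} {n = n} {xs} (_ , _ , _ , _ , _ , constant) inRange =
  ConstantSeq-All constant (Δ^-Bounded d (Δ xs) (Δ-InRange n xs inRange))

-- Here N = suc n, and orderDifferences D lists the pairs (D′, b) with 1 ≤ D′ ≤ D and
-- |b| ≤ 2^(D′-1) n.
module Candidates (n : ℕ) where

  symRange : ℕ → List ℤ
  symRange w = range (- + w) (suc (w + w))

  ∈-symRange : ∀ {w b} → Bounded w b → b ∈ symRange w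
  ∈-symRange {w} {b} (lo≤b , b≤w) = ∈-range (w + w) (lo≤b , subst (b ≤ℤ_) (sym (cancel (+ w))) b≤w)
    where
    cancel : ∀ i → - i +ℤ (i +ℤ i) ≡ i
    cancel = ℤ-Solver.solve-∀

  differencesOfOrder : ℕ → List (ℕ × ℤ)
  differencesOfOrder d = map (suc d ,_) (symRange (2 ^ d * n))

  length-differencesOfOrder : ∀ d → length (differencesOfOrder d) ≡ suc (2 ^ d * n + 2 ^ d * n)
  length-differencesOfOrder d = trans (length-map _ (symRange w)) (length-range (- + w) (suc (w + w)))
    where w = 2 ^ d * n

  orderDifferences : ℕ → List (ℕ × ℤ)
  orderDifferences zero    = []
  orderDifferences (suc d) = orderDifferences d ++ differencesOfOrder d

  ∈-orderDifferences : ∀ D d {b} → suc d ≤ D → Bounded (2 ^ d * n) b → (suc d , b) ∈ orderDifferences D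
  ∈-orderDifferences (suc D) d (s≤s d≤D) bounded with ℕ.m≤n⇒m<n∨m≡n d≤D
  ... | inj₁ d<D  = ∈-++⁺ˡ (∈-orderDifferences D d d<D bounded)
  ... | inj₂ refl = ∈-++⁺ʳ (orderDifferences d) (∈-map⁺ (suc d ,_) (∈-symRange bounded))

  length-orderDifferences : ∀ D → suc (length (orderDifferences D)) ≤ 2 ^ suc D * suc n
  length-orderDifferences zero    = s≤s z≤n
  length-orderDifferences (suc D) = begin
    suc (length (orderDifferences D ++ differencesOfOrder D))
      ≡⟨ cong suc (length-++ (orderDifferences D)) ⟩
    suc (length (orderDifferences D) + length (differencesOfOrder D))
      ≡⟨ cong (λ l → suc (length (orderDifferences D) + l)) (length-differencesOfOrder D) ⟩
    suc (length (orderDifferences D) + suc (p * n + p * n))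
      ≡⟨ regroup (length (orderDifferences D)) p n ⟩
    suc (length (orderDifferences D)) + (2 * p * n + 1)
      ≤⟨ ℕ.+-mono-≤ (length-orderDifferences D) (ℕ.+-monoʳ-≤ (2 * p * n) 1≤2p) ⟩
    2 * p * suc n + (2 * p * n + 2 * p)
      ≡⟨ double p n ⟩
    2 * (2 * p) * suc n ∎
    where
    open ℕ.≤-Reasoning
    p = 2 ^ D
    1≤2p : 1 ≤ 2 * p
    1≤2p = ℕ.≤-trans (ℕ.m^n>0 2 D) (ℕ.m≤n*m p 2)
    regroup : ∀ l p n → suc (l + suc (p * n + p * n)) ≡ suc l + (2 * p * n + 1)
    regroup = ℕ-Solver.solve-∀
    double : ∀ p n → 2 * p * suc n + (2 * p * n + 2 * p) ≡ 2 * (2 * p) * suc n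
    double = ℕ-Solver.solve-∀

  candidates : ℕ → List (ℕ × ℤ × ℤ)
  candidates D = cartesianProductWith (λ (d , b) a → d , a , b) (orderDifferences D) (range (+ 1) (suc n))

  counted⇒∈candidates : ∀ k D {t} → Counted k D (suc n) t → t ∈ candidates D
  counted⇒∈candidates k D {zero , _} (() , _)
  counted⇒∈candidates k D {suc d , a , b} (_ , d<D , xs , progression@(_ , _ , _ , (_ , refl) , _) , inRange) =
    ∈-cartesianProductWith⁺ (λ (d , b) a → d , a , b)
      (∈-orderDifferences D d d<D (Progression-InRange⇒Bounded progression inRange))
      (∈-range n (All.head inRange))

  length-candidates< : ∀ D → length (candidates D) < 2 ^ (D + 1) * suc n ^ 2
  length-candidates< D = begin-strict
    length (candidates D)
      ≡⟨ length-cartesianProductWith _ (orderDifferences D) (range (+ 1) (suc n)) ⟩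
    length (orderDifferences D) * length (range (+ 1) (suc n))
      ≡⟨ cong (length (orderDifferences D) *_) (length-range (+ 1) (suc n)) ⟩
    length (orderDifferences D) * suc n
      <⟨ ℕ.m<n+m _ (s≤s z≤n) ⟩
    suc (length (orderDifferences D)) * suc n
      ≤⟨ ℕ.*-monoˡ-≤ (suc n) (length-orderDifferences D) ⟩
    2 ^ suc D * suc n * suc n
      ≡⟨ reshape (2 ^ suc D) (suc n) ⟩
    2 ^ suc D * suc n ^ 2
      ≡⟨ cong (λ e → 2 ^ e * suc n ^ 2) (ℕ.+-comm 1 D) ⟩
    2 ^ (D + 1) * suc n ^ 2 ∎
    where
    open ℕ.≤-Reasoning
    reshape : ∀ q m → q * m * m ≡ q * m ^ 2
    reshape q m = trans (ℕ.*-assoc q m m) (cong (λ v → q * (m * v)) (sym (ℕ.*-identityʳ m)))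

lemma8 : (k D N : ℕ) → 1 ≤ k → 1 ≤ D → 1 ≤ N → D ≤ k →
    (ts : List (ℕ × ℤ × ℤ)) → Unique ts → All (Counted k D N) ts →
    length ts < 2 ^ (D + 1) * N ^ 2
lemma8 k D zero    _ _ () _ _ _ _
lemma8 k D (suc n) _ _ _  _ ts unique counted =
  ℕ.≤-<-trans (Unique-⊆⇒length≤ unique (counted⇒∈candidates k D ∘ lookup counted))
              (length-candidates< D)
  where open Candidates n
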